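{- For all integers $n,k,r\ge 0$ with $n\ge k$, \[ L_{r}(n,k)=\sum_{m=k}^{n}(-1)^{n-m}S_{2}(m,k\,|\,2r)\,S_{1}(n,m). \]
   Context: For a nonnegative integer $r$ and integers $0\le k\le n$, the $r$-Lah number $L_r(n,k)$ is the number of partitions of a set with $n+r$ elements into $k+r$ non-empty linearly ordered subsets such that $r$ distinguished elements lie in distinct subsets; its exponential generating function is $\sum_{n\ge k}L_r(n,k)\frac{t^n}{n!}=\frac{1}{k!}\left(\frac{1}{1-t}-1\right)^k\left(\frac{1}{1-t}\right)^{2r}$. The Stirling polynomials of the second kind are defined by $\frac1{k!}e^{xt}(e^t-1)^k=\sum_{n\ge k}S_2(n,k\,|\,x)\frac{t^n}{n!}$. The (signed) Stirling numbers of the first kind $S_1(n,m)$ are defined by $(x)_n=\sum_{m=0}^nS_1(n,m)x^m$, where $(x)_n=x(x-1)\cdots(x-n+1)$. -}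

module Defs where

open import Data.Nat as ℕ using (ℕ; zero; suc; _!)
open import Data.Nat.Properties using (_!≢0)
open import Data.Integer as ℤ using (ℤ; +_)
open import Data.Rational as ℚ using (ℚ; _/_; 0ℚ; 1ℚ)

Series : Set
Series = ℕ → ℚ

sumTo : ℕ → (ℕ → ℚ) → ℚ
sumTo zero    f = f 0
sumTo (suc n) f = sumTo n f ℚ.+ f (suc n)

_⊛_ : Series → Series → Series
(f ⊛ g) n = sumTo n (λ i → f i ℚ.* g (n ℕ.∸ i))

one : Series
one zero    = 1ℚ
one (suc _) = 0ℚ

_^ˢ_ : Series → ℕ → Series
f ^ˢ zero  = one
f ^ˢ suc k = f ⊛ (f ^ˢ k)

scale : ℚ → Series → Series
scale c f n = c ℚ.* f n

-- 1/(1-t) = Σ t^n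
geom : Series
geom _ = 1ℚ

geomMinusOne : Series
geomMinusOne zero    = 0ℚ
geomMinusOne (suc _) = 1ℚ

invFact : ℕ → ℚ
invFact k = (+ 1 / (k !)) {{k !≢0}}

toℚ : ℤ → ℚ
toℚ z = z / 1

_^ᵠ_ : ℚ → ℕ → ℚ
x ^ᵠ zero  = 1ℚ
x ^ᵠ suc n = x ℚ.* (x ^ᵠ n)

-- e^{x t} = Σ x^n t^n / n!
expS : ℚ → Series
expS x n = (x ^ᵠ n) ℚ.* invFact n

expMinusOne : Series
expMinusOne zero    = 0ℚ
expMinusOne (suc n) = invFact (suc n)

-- the coefficient of t^n/n! of an exponential generating function
egfCoeff : Series → ℕ → ℚ
egfCoeff f n = toℚ (+ (n !)) ℚ.* f n

-- r-Lah numbers via their EGF: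
--   Σ_{n≥k} L_r(n,k) t^n/n! = (1/k!) (1/(1-t) - 1)^k (1/(1-t))^{2r}
lah : ℕ → ℕ → ℕ → ℚ
lah r n k = egfCoeff (scale (invFact k) ((geomMinusOne ^ˢ k) ⊛ (geom ^ˢ (2 ℕ.* r)))) n

-- Stirling polynomials of the second kind:
--   (1/k!) e^{xt} (e^t - 1)^k = Σ_{n≥k} S₂(n,k|x) t^n/n!
S₂ : ℕ → ℕ → ℚ → ℚ
S₂ n k x = egfCoeff (scale (invFact k) (expS x ⊛ (expMinusOne ^ˢ k))) n

-- Coefficients of the falling factorial (x)_n = x(x-1)...(x-n+1):
-- fallingCoeff n m is the coefficient of x^m in (x)_n.
-- (x)_0 = 1,  (x)_{n+1} = (x)_n · (x - n).
fallingCoeff : ℕ → ℕ → ℤ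
fallingCoeff zero    zero    = + 1
fallingCoeff zero    (suc m) = + 0
fallingCoeff (suc n) zero    = ℤ.- (+ n ℤ.* fallingCoeff n zero)
fallingCoeff (suc n) (suc m) = fallingCoeff n m ℤ.- (+ n ℤ.* fallingCoeff n (suc m))

-- Signed Stirling numbers of the first kind: (x)_n = Σ_m S₁(n,m) x^m
S₁ : ℕ → ℕ → ℤ
S₁ = fallingCoeff

sumFromTo : ℕ → ℕ → (ℕ → ℚ) → ℚ
sumFromTo a b f = sumTo (b ℕ.∸ a) (λ j → f (a ℕ.+ j))

-- Both sides are triangles u with u 0 k = δ₀ₖ and u (n+1) k = u n (k-1) + (n + k + 2r) · u n k.
-- For the Lah numbers this is read off Fₖ = (1/(1-t) - 1)ᵏ (1-t)^(-2r): the derivation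
-- (1-t) d/dt fixes 1/(1-t) and sends 1/(1-t) - 1 to itself plus 1, so
-- (1-t) Fₖ' = (k + 2r) Fₖ + k Fₖ₋₁, and the factor 1/k! of the EGF absorbs the k.
-- Likewise d/dt on e^{xt} (e^t - 1)ᵏ gives S₂(m+1,k|x) = S₂(m,k-1|x) + (k + x) S₂(m,k|x),
-- while c(n,m) = (-1)^(n-m) S₁(n,m) satisfies c(n+1,m) = c(n,m-1) + n c(n,m).
-- Multiplying a triangle with row weights p n by one with column weights q k gives a
-- triangle with weights p n + q k, so Σₘ c(n,m) S₂(m,k|2r) obeys the Lah recurrence.

{-# OPTIONS --safe #-}
module Submission where

open import Defs
open import Algebra.Bundles using (CommutativeMonoid)
open import Data.Nat as ℕ using (ℕ; zero; suc; pred; _≤_; _<_; z≤n; s≤s; _!)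
import Data.Nat.Properties as ℕₚ
open import Data.Integer as ℤ using (ℤ; +_)
import Data.Integer.Properties as ℤₚ
open import Data.Rational as ℚ using (ℚ; _/_; _+_; _*_; -_; _-_; 0ℚ; 1ℚ)
import Data.Rational.Properties as ℚₚ
import Data.Rational.Unnormalised as ℚᵘ
import Data.Rational.Unnormalised.Properties as ℚᵘₚ
open import Data.Rational.Solver using (module +-*-Solver)
open import Data.Product using (_,_)
open import Function using (_∘_)
open import Relation.Binary.PropositionalEquality
open import Relation.Nullary using (Dec; yes; no)

open +-*-Solver using (solve; _:=_; _:+_; _:*_; _:-_; :-_; con)
open import Algebra.Properties.CommutativeSemigroup
  (CommutativeMonoid.commutativeSemigroup ℚₚ.*-1-commutativeMonoid)
  using (xy∙z≈xz∙y; x∙yz≈y∙xz)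

toℚᵘ-toℚ : ∀ z → ℚ.toℚᵘ (toℚ z) ℚᵘ.≃ ℚᵘ.mkℚᵘ z 0
toℚᵘ-toℚ z = ℚₚ.toℚᵘ-fromℚᵘ (ℚᵘ.mkℚᵘ z 0)

toℚ-+ : ∀ a b → toℚ (a ℤ.+ b) ≡ toℚ a + toℚ b
toℚ-+ a b = ℚₚ.toℚᵘ-injective (begin
  ℚ.toℚᵘ (toℚ (a ℤ.+ b))               ≈⟨ toℚᵘ-toℚ (a ℤ.+ b) ⟩
  ℚᵘ.mkℚᵘ (a ℤ.+ b) 0                   ≈⟨ ℚᵘ.*≡* a+b≡a*1+b*1 ⟩
  ℚᵘ.mkℚᵘ a 0 ℚᵘ.+ ℚᵘ.mkℚᵘ b 0          ≈⟨ ℚᵘₚ.+-cong (toℚᵘ-toℚ a) (toℚᵘ-toℚ b) ⟨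
  ℚ.toℚᵘ (toℚ a) ℚᵘ.+ ℚ.toℚᵘ (toℚ b)    ≈⟨ ℚₚ.toℚᵘ-homo-+ (toℚ a) (toℚ b) ⟨
  ℚ.toℚᵘ (toℚ a + toℚ b)                ∎)
  where
  open ℚᵘₚ.≃-Reasoning
  a+b≡a*1+b*1 : (a ℤ.+ b) ℤ.* + 1 ≡ (a ℤ.* + 1 ℤ.+ b ℤ.* + 1) ℤ.* + 1
  a+b≡a*1+b*1 = cong (ℤ._* + 1) (sym (cong₂ ℤ._+_ (ℤₚ.*-identityʳ a) (ℤₚ.*-identityʳ b)))

toℚ-* : ∀ a b → toℚ (a ℤ.* b) ≡ toℚ a * toℚ b
toℚ-* a b = ℚₚ.toℚᵘ-injective (begin
  ℚ.toℚᵘ (toℚ (a ℤ.* b))               ≈⟨ toℚᵘ-toℚ (a ℤ.* b) ⟩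
  ℚᵘ.mkℚᵘ a 0 ℚᵘ.* ℚᵘ.mkℚᵘ b 0          ≈⟨ ℚᵘₚ.*-cong (toℚᵘ-toℚ a) (toℚᵘ-toℚ b) ⟨
  ℚ.toℚᵘ (toℚ a) ℚᵘ.* ℚ.toℚᵘ (toℚ b)    ≈⟨ ℚₚ.toℚᵘ-homo-* (toℚ a) (toℚ b) ⟨
  ℚ.toℚᵘ (toℚ a * toℚ b)                ∎)
  where open ℚᵘₚ.≃-Reasoning

toℚ-neg : ∀ a → toℚ (ℤ.- a) ≡ - toℚ a
toℚ-neg a = ℚₚ.toℚᵘ-injective (begin
  ℚ.toℚᵘ (toℚ (ℤ.- a))     ≈⟨ toℚᵘ-toℚ (ℤ.- a) ⟩
  ℚᵘ.- ℚᵘ.mkℚᵘ a 0          ≈⟨ ℚᵘₚ.-‿cong (toℚᵘ-toℚ a) ⟨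
  ℚᵘ.- ℚ.toℚᵘ (toℚ a)       ≈⟨ ℚₚ.toℚᵘ-homo‿- (toℚ a) ⟨
  ℚ.toℚᵘ (- toℚ a)          ∎)
  where open ℚᵘₚ.≃-Reasoning

toℚ-sub : ∀ a b → toℚ (a ℤ.- b) ≡ toℚ a - toℚ b
toℚ-sub a b = trans (toℚ-+ a (ℤ.- b)) (cong (λ q → toℚ a + q) (toℚ-neg b))

ι : ℕ → ℚ
ι n = toℚ (+ n)

ι-+ : ∀ m n → ι (m ℕ.+ n) ≡ ι m + ι n
ι-+ m n = trans (cong toℚ (ℤₚ.pos-+ m n)) (toℚ-+ (+ m) (+ n))

ι-* : ∀ m n → ι (m ℕ.* n) ≡ ι m * ι n
ι-* m n = trans (cong toℚ (ℤₚ.pos-* m n)) (toℚ-* (+ m) (+ n))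

ι-suc : ∀ n → ι (suc n) ≡ 1ℚ + ι n
ι-suc = ι-+ 1

ι-∸ : ∀ {i n} → i ≤ n → ι n ≡ ι i + ι (n ℕ.∸ i)
ι-∸ {i} {n} i≤n = trans (cong ι (sym (ℕₚ.m+[n∸m]≡n i≤n))) (ι-+ i (n ℕ.∸ i))

1/-scale : ∀ a b → (+ 1 / suc a) ≡ ι (suc b) * (+ 1 / (suc b ℕ.* suc a))
1/-scale a b = ℚₚ.toℚᵘ-injective (begin
  ℚ.toℚᵘ (+ 1 / suc a)                                   ≈⟨ ℚₚ.toℚᵘ-fromℚᵘ (ℚᵘ.mkℚᵘ (+ 1) a) ⟩
  ℚᵘ.mkℚᵘ (+ 1) a                                         ≈⟨ ℚᵘ.*≡* 1*[b*a]≡[b*1]*a ⟩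
  ℚᵘ.mkℚᵘ (+ suc b) 0 ℚᵘ.* ℚᵘ.mkℚᵘ (+ 1) (pred (suc b ℕ.* suc a))
    ≈⟨ ℚᵘₚ.*-cong (toℚᵘ-toℚ (+ suc b)) (ℚₚ.toℚᵘ-fromℚᵘ (ℚᵘ.mkℚᵘ (+ 1) (pred (suc b ℕ.* suc a)))) ⟨
  ℚ.toℚᵘ (ι (suc b)) ℚᵘ.* ℚ.toℚᵘ (+ 1 / (suc b ℕ.* suc a))
    ≈⟨ ℚₚ.toℚᵘ-homo-* (ι (suc b)) (+ 1 / (suc b ℕ.* suc a)) ⟨
  ℚ.toℚᵘ (ι (suc b) * (+ 1 / (suc b ℕ.* suc a)))          ∎)
  where
  open ℚᵘₚ.≃-Reasoning
  1*[b*a]≡[b*1]*a : + 1 ℤ.* + (1 ℕ.* (suc b ℕ.* suc a)) ≡ (+ suc b ℤ.* + 1) ℤ.* + suc a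
  1*[b*a]≡[b*1]*a = trans (ℤₚ.*-identityˡ _) (trans (cong +_ (ℕₚ.*-identityˡ _))
    (trans (ℤₚ.pos-* (suc b) (suc a)) (cong (ℤ._* + suc a) (sym (ℤₚ.*-identityʳ (+ suc b))))))

invFact-suc : ∀ k → invFact k ≡ ι (suc k) * invFact (suc k)
invFact-suc k = helper (k !) {{k ℕₚ.!≢0}}
  where
  helper : ∀ m .{{_ : ℕ.NonZero m}} →
           (+ 1 / m) ≡ ι (suc k) * ((+ 1 / (suc k ℕ.* m)) {{ℕₚ.m*n≢0 (suc k) m}})
  helper (suc a) = 1/-scale a k

open ≡-Reasoning

-- Finite sums

sumTo-cong≤ : ∀ n {f g : ℕ → ℚ} → (∀ i → i ≤ n → f i ≡ g i) → sumTo n f ≡ sumTo n g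
sumTo-cong≤ zero    f≡g = f≡g 0 z≤n
sumTo-cong≤ (suc n) f≡g =
  cong₂ _+_ (sumTo-cong≤ n (λ i i≤n → f≡g i (ℕₚ.m≤n⇒m≤1+n i≤n))) (f≡g (suc n) ℕₚ.≤-refl)

sumTo-cong : ∀ n {f g : ℕ → ℚ} → f ≗ g → sumTo n f ≡ sumTo n g
sumTo-cong n f≗g = sumTo-cong≤ n (λ i _ → f≗g i)

sumTo-+ : ∀ n (f g : ℕ → ℚ) → sumTo n (λ i → f i + g i) ≡ sumTo n f + sumTo n g
sumTo-+ zero    f g = refl
sumTo-+ (suc n) f g = begin
  sumTo n (λ i → f i + g i) + (f (suc n) + g (suc n))  ≡⟨ cong (_+ (f (suc n) + g (suc n))) (sumTo-+ n f g) ⟩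
  (sumTo n f + sumTo n g) + (f (suc n) + g (suc n))    ≡⟨ +-interchange (sumTo n f) (sumTo n g) (f (suc n)) (g (suc n)) ⟩
  (sumTo n f + f (suc n)) + (sumTo n g + g (suc n))    ∎
  where
  +-interchange : ∀ a b c d → (a + b) + (c + d) ≡ (a + c) + (b + d)
  +-interchange = solve 4 (λ a b c d → (a :+ b) :+ (c :+ d) := (a :+ c) :+ (b :+ d)) refl

sumTo-sub : ∀ n (f g : ℕ → ℚ) → sumTo n (λ i → f i - g i) ≡ sumTo n f - sumTo n g
sumTo-sub zero    f g = refl
sumTo-sub (suc n) f g = begin
  sumTo n (λ i → f i - g i) + (f (suc n) - g (suc n))  ≡⟨ cong (_+ (f (suc n) - g (suc n))) (sumTo-sub n f g) ⟩
  (sumTo n f - sumTo n g) + (f (suc n) - g (suc n))    ≡⟨ sub-interchange (sumTo n f) (sumTo n g) (f (suc n)) (g (suc n)) ⟩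
  (sumTo n f + f (suc n)) - (sumTo n g + g (suc n))    ∎
  where
  sub-interchange : ∀ a b c d → (a - b) + (c - d) ≡ (a + c) - (b + d)
  sub-interchange = solve 4 (λ a b c d → (a :- b) :+ (c :- d) := (a :+ c) :- (b :+ d)) refl

sumTo-scale : ∀ n c (f : ℕ → ℚ) → sumTo n (λ i → c * f i) ≡ c * sumTo n f
sumTo-scale zero    c f = refl
sumTo-scale (suc n) c f =
  trans (cong (_+ c * f (suc n)) (sumTo-scale n c f)) (sym (ℚₚ.*-distribˡ-+ c (sumTo n f) (f (suc n))))

sumTo-zero : ∀ n {f : ℕ → ℚ} → (∀ i → f i ≡ 0ℚ) → sumTo n f ≡ 0ℚ
sumTo-zero zero    f≡0 = f≡0 0
sumTo-zero (suc n) f≡0 = cong₂ _+_ (sumTo-zero n f≡0) (f≡0 (suc n))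

sumTo-suc : ∀ n (f : ℕ → ℚ) → sumTo (suc n) f ≡ f 0 + sumTo n (f ∘ suc)
sumTo-suc zero    f = refl
sumTo-suc (suc n) f =
  trans (cong (_+ f (suc (suc n))) (sumTo-suc n f)) (ℚₚ.+-assoc (f 0) (sumTo n (f ∘ suc)) (f (suc (suc n))))

sumTo-dropPrefix : ∀ k d (f : ℕ → ℚ) → (∀ m → m < k → f m ≡ 0ℚ) →
                   sumTo (k ℕ.+ d) f ≡ sumTo d (λ j → f (k ℕ.+ j))
sumTo-dropPrefix zero    d f _     = refl
sumTo-dropPrefix (suc k) d f f<k≡0 = begin
  sumTo (suc (k ℕ.+ d)) f                ≡⟨ sumTo-suc (k ℕ.+ d) f ⟩
  f 0 + sumTo (k ℕ.+ d) (f ∘ suc)        ≡⟨ cong₂ _+_ (f<k≡0 0 (s≤s z≤n))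
                                              (sumTo-dropPrefix k d (f ∘ suc) (λ m m<k → f<k≡0 (suc m) (s≤s m<k))) ⟩
  0ℚ + sumTo d (λ j → f (suc k ℕ.+ j))   ≡⟨ ℚₚ.+-identityˡ _ ⟩
  sumTo d (λ j → f (suc k ℕ.+ j))        ∎

sumFromTo≡sumTo : ∀ {k n} (f : ℕ → ℚ) → k ≤ n → (∀ m → m < k → f m ≡ 0ℚ) → sumFromTo k n f ≡ sumTo n f
sumFromTo≡sumTo {k} f k≤n f<k≡0 with ℕₚ.m≤n⇒∃[o]m+o≡n k≤n
... | d , refl = trans (cong (λ e → sumTo e (λ j → f (k ℕ.+ j))) (ℕₚ.m+n∸m≡n k d))
                       (sym (sumTo-dropPrefix k d f f<k≡0))

-- Triangular arrays

shift : (ℕ → ℚ) → ℕ → ℚ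
shift f zero    = 0ℚ
shift f (suc k) = f k

shift-cong : ∀ {f g} → f ≗ g → shift f ≗ shift g
shift-cong f≗g zero    = refl
shift-cong f≗g (suc k) = f≗g k

record IsTriangle (c u : ℕ → ℕ → ℚ) : Set where
  field
    row-zero : ∀ k → u 0 k ≡ one k
    row-suc  : ∀ n k → u (suc n) k ≡ shift (u n) k + c n k * u n k

open IsTriangle

IsTriangle-unique : ∀ {c u v} → IsTriangle c u → IsTriangle c v → ∀ n k → u n k ≡ v n k
IsTriangle-unique U V zero    k = trans (row-zero U k) (sym (row-zero V k))
IsTriangle-unique {c} {u} {v} U V (suc n) k = begin
  u (suc n) k                    ≡⟨ row-suc U n k ⟩
  shift (u n) k + c n k * u n k  ≡⟨ cong₂ (λ s t → s + c n k * t) (shift-cong (IsTriangle-unique U V n) k)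
                                                                  (IsTriangle-unique U V n k) ⟩
  shift (v n) k + c n k * v n k  ≡⟨ row-suc V n k ⟨
  v (suc n) k                    ∎

IsTriangle-zero-above : ∀ {c u} → IsTriangle c u → ∀ {n k} → n < k → u n k ≡ 0ℚ
IsTriangle-zero-above U {zero}  {suc k} _         = row-zero U (suc k)
IsTriangle-zero-above {c} {u} U {suc n} {suc k} (s≤s n<k) = begin
  u (suc n) (suc k)                  ≡⟨ row-suc U n (suc k) ⟩
  u n k + c n (suc k) * u n (suc k)  ≡⟨ cong₂ (λ s t → s + c n (suc k) * t)
                                         (IsTriangle-zero-above U n<k) (IsTriangle-zero-above U (ℕₚ.m≤n⇒m≤1+n n<k)) ⟩
  0ℚ + c n (suc k) * 0ℚ              ≡⟨ cong (λ z → 0ℚ + z) (ℚₚ.*-zeroʳ (c n (suc k))) ⟩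
  0ℚ                                 ∎

-- The sum stops at m = n because the left factor is zero above the diagonal.
_⋆_ : (ℕ → ℕ → ℚ) → (ℕ → ℕ → ℚ) → ℕ → ℕ → ℚ
(a ⋆ s) n k = sumTo n (λ m → a n m * s m k)

IsTriangle-⋆ : ∀ {p q : ℕ → ℚ} {a s} → IsTriangle (λ n _ → p n) a → IsTriangle (λ _ k → q k) s →
               IsTriangle (λ n k → p n + q k) (a ⋆ s)
row-zero (IsTriangle-⋆ {a = a} {s} A S) k = begin
  a 0 0 * s 0 k  ≡⟨ cong₂ _*_ (row-zero A 0) (row-zero S k) ⟩
  1ℚ * one k     ≡⟨ ℚₚ.*-identityˡ (one k) ⟩
  one k          ∎
row-suc (IsTriangle-⋆ {p} {q} {a} {s} A S) n k = begin
  sumTo (suc n) (λ m → a (suc n) m * s m k)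
    ≡⟨ sumTo-cong (suc n) (λ m → trans (cong (_* s m k) (row-suc A n m))
                                       (distrib-assoc (shift (a n) m) (p n) (a n m) (s m k))) ⟩
  sumTo (suc n) (λ m → shift (a n) m * s m k + p n * (a n m * s m k))
    ≡⟨ sumTo-+ (suc n) _ _ ⟩
  sumTo (suc n) (λ m → shift (a n) m * s m k) + sumTo (suc n) (λ m → p n * (a n m * s m k))
    ≡⟨ cong₂ _+_ shifted (trans (sumTo-scale (suc n) (p n) _) (cong (p n *_) diagonal)) ⟩
  (shift (T n) k + q k * T n k) + p n * T n k
    ≡⟨ collect (shift (T n) k) (q k) (p n) (T n k) ⟩
  shift (T n) k + (p n + q k) * T n k
    ∎
  where
  T : ℕ → ℕ → ℚ
  T = a ⋆ s

  distrib-assoc : ∀ x y z w → (x + y * z) * w ≡ x * w + y * (z * w)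
  distrib-assoc = solve 4 (λ x y z w → (x :+ y :* z) :* w := x :* w :+ y :* (z :* w)) refl

  collect : ∀ x y z w → (x + y * w) + z * w ≡ x + (z + y) * w
  collect = solve 4 (λ x y z w → (x :+ y :* w) :+ z :* w := x :+ (z :+ y) :* w) refl

  diagonal : sumTo (suc n) (λ m → a n m * s m k) ≡ T n k
  diagonal = begin
    T n k + a n (suc n) * s (suc n) k  ≡⟨ cong (λ z → T n k + z * s (suc n) k) (IsTriangle-zero-above A ℕₚ.≤-refl) ⟩
    T n k + 0ℚ * s (suc n) k           ≡⟨ cong (λ z → T n k + z) (ℚₚ.*-zeroˡ (s (suc n) k)) ⟩
    T n k + 0ℚ                         ≡⟨ ℚₚ.+-identityʳ (T n k) ⟩
    T n k                              ∎

  shift-inside : ∀ j → sumTo n (λ m → a n m * shift (s m) j) ≡ shift (T n) j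
  shift-inside zero    = sumTo-zero n (λ m → ℚₚ.*-zeroʳ (a n m))
  shift-inside (suc j) = refl

  shifted : sumTo (suc n) (λ m → shift (a n) m * s m k) ≡ shift (T n) k + q k * T n k
  shifted = begin
    sumTo (suc n) (λ m → shift (a n) m * s m k)
      ≡⟨ sumTo-suc n _ ⟩
    0ℚ * s 0 k + sumTo n (λ m → a n m * s (suc m) k)
      ≡⟨ cong₂ _+_ (ℚₚ.*-zeroˡ (s 0 k)) (sumTo-cong n (λ m → cong (a n m *_) (row-suc S m k))) ⟩
    0ℚ + sumTo n (λ m → a n m * (shift (s m) k + q k * s m k))
      ≡⟨ ℚₚ.+-identityˡ _ ⟩
    sumTo n (λ m → a n m * (shift (s m) k + q k * s m k))
      ≡⟨ sumTo-cong n (λ m → ℚₚ.*-distribˡ-+ (a n m) (shift (s m) k) (q k * s m k)) ⟩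
    sumTo n (λ m → a n m * shift (s m) k + a n m * (q k * s m k))
      ≡⟨ sumTo-+ n _ _ ⟩
    sumTo n (λ m → a n m * shift (s m) k) + sumTo n (λ m → a n m * (q k * s m k))
      ≡⟨ cong₂ _+_ (shift-inside k)
                   (trans (sumTo-cong n (λ m → x∙yz≈y∙xz (a n m) (q k) (s m k))) (sumTo-scale n (q k) _)) ⟩
    shift (T n) k + q k * T n k
      ∎

-- Formal power series and derivations

infixl 6 _+ˢ_ _-ˢ_

_+ˢ_ : Series → Series → Series
(f +ˢ g) n = f n + g n

_-ˢ_ : Series → Series → Series
(f -ˢ g) n = f n - g n

⊛-congˡ : ∀ {f g} h → f ≗ g → f ⊛ h ≗ g ⊛ h
⊛-congˡ h f≗g n = sumTo-cong n (λ i → cong (_* h (n ℕ.∸ i)) (f≗g i))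

⊛-congʳ : ∀ f {g h} → g ≗ h → f ⊛ g ≗ f ⊛ h
⊛-congʳ f g≗h n = sumTo-cong n (λ i → cong (f i *_) (g≗h (n ℕ.∸ i)))

⊛-distribʳ-+ : ∀ f g h → (f +ˢ g) ⊛ h ≗ f ⊛ h +ˢ g ⊛ h
⊛-distribʳ-+ f g h n =
  trans (sumTo-cong n (λ i → ℚₚ.*-distribʳ-+ (h (n ℕ.∸ i)) (f i) (g i))) (sumTo-+ n _ _)

⊛-distribˡ-+ : ∀ f g h → f ⊛ (g +ˢ h) ≗ f ⊛ g +ˢ f ⊛ h
⊛-distribˡ-+ f g h n =
  trans (sumTo-cong n (λ i → ℚₚ.*-distribˡ-+ (f i) (g (n ℕ.∸ i)) (h (n ℕ.∸ i)))) (sumTo-+ n _ _)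

⊛-distribʳ-sub : ∀ f g h → (f -ˢ g) ⊛ h ≗ f ⊛ h -ˢ g ⊛ h
⊛-distribʳ-sub f g h n = trans (sumTo-cong n (λ i → *-distribʳ-sub (f i) (g i) (h (n ℕ.∸ i)))) (sumTo-sub n _ _)
  where
  *-distribʳ-sub : ∀ x y z → (x - y) * z ≡ x * z - y * z
  *-distribʳ-sub = solve 3 (λ x y z → (x :- y) :* z := x :* z :- y :* z) refl

⊛-distribˡ-sub : ∀ f g h → f ⊛ (g -ˢ h) ≗ f ⊛ g -ˢ f ⊛ h
⊛-distribˡ-sub f g h n = trans (sumTo-cong n (λ i → *-distribˡ-sub (f i) (g (n ℕ.∸ i)) (h (n ℕ.∸ i)))) (sumTo-sub n _ _)
  where
  *-distribˡ-sub : ∀ x y z → x * (y - z) ≡ x * y - x * z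
  *-distribˡ-sub = solve 3 (λ x y z → x :* (y :- z) := x :* y :- x :* z) refl

⊛-scaleˡ : ∀ c f g → scale c f ⊛ g ≗ scale c (f ⊛ g)
⊛-scaleˡ c f g n = trans (sumTo-cong n (λ i → ℚₚ.*-assoc c (f i) (g (n ℕ.∸ i)))) (sumTo-scale n c _)

⊛-scaleʳ : ∀ c f g → f ⊛ scale c g ≗ scale c (f ⊛ g)
⊛-scaleʳ c f g n = trans (sumTo-cong n (λ i → x∙yz≈y∙xz (f i) c (g (n ℕ.∸ i)))) (sumTo-scale n c _)

⊛-identityˡ : ∀ f → one ⊛ f ≗ f
⊛-identityˡ f zero    = ℚₚ.*-identityˡ (f 0)
⊛-identityˡ f (suc n) = begin
  (one ⊛ f) (suc n)                                  ≡⟨ sumTo-suc n _ ⟩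
  1ℚ * f (suc n) + sumTo n (λ i → 0ℚ * f (n ℕ.∸ i))  ≡⟨ cong₂ _+_ (ℚₚ.*-identityˡ (f (suc n)))
                                                          (sumTo-zero n (λ i → ℚₚ.*-zeroˡ (f (n ℕ.∸ i)))) ⟩
  f (suc n) + 0ℚ                                     ≡⟨ ℚₚ.+-identityʳ (f (suc n)) ⟩
  f (suc n)                                          ∎

^ˢ-constantTerm : ∀ f k → (f ^ˢ k) 0 ≡ f 0 ^ᵠ k
^ˢ-constantTerm f zero    = refl
^ˢ-constantTerm f (suc k) = cong (f 0 *_) (^ˢ-constantTerm f k)

0ℚ^ᵠ≡one : ∀ k → 0ℚ ^ᵠ k ≡ one k
0ℚ^ᵠ≡one zero    = refl
0ℚ^ᵠ≡one (suc k) = ℚₚ.*-zeroˡ (0ℚ ^ᵠ k)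

1ℚ^ᵠ≡1ℚ : ∀ k → 1ℚ ^ᵠ k ≡ 1ℚ
1ℚ^ᵠ≡1ℚ zero    = refl
1ℚ^ᵠ≡1ℚ (suc k) = trans (ℚₚ.*-identityˡ (1ℚ ^ᵠ k)) (1ℚ^ᵠ≡1ℚ k)

record IsDerivation (∂ : Series → Series) : Set where
  field
    leibniz : ∀ f g → ∂ (f ⊛ g) ≗ ∂ f ⊛ g +ˢ f ⊛ ∂ g
    ∂-one   : ∀ n → ∂ one n ≡ 0ℚ

open IsDerivation

θ : Series → Series
θ f n = ι n * f n

D : Series → Series
D f n = θ f (suc n)

[1-t]D : Series → Series
[1-t]D f = D f -ˢ θ f

θ-one : ∀ n → θ one n ≡ 0ℚ
θ-one zero    = refl
θ-one (suc n) = ℚₚ.*-zeroʳ (ι (suc n))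

isDerivation-θ : IsDerivation θ
leibniz isDerivation-θ f g n = begin
  ι n * sumTo n h                                                     ≡⟨ sumTo-scale n (ι n) h ⟨
  sumTo n (λ i → ι n * h i)                                           ≡⟨ sumTo-cong≤ n split ⟩
  sumTo n (λ i → θ f i * g (n ℕ.∸ i) + f i * θ g (n ℕ.∸ i))          ≡⟨ sumTo-+ n _ _ ⟩
  (θ f ⊛ g) n + (f ⊛ θ g) n                                           ∎
  where
  h : ℕ → ℚ
  h i = f i * g (n ℕ.∸ i)

  distrib : ∀ a b x y → (a + b) * (x * y) ≡ (a * x) * y + x * (b * y)
  distrib = solve 4 (λ a b x y → (a :+ b) :* (x :* y) := (a :* x) :* y :+ x :* (b :* y)) refl

  split : ∀ i → i ≤ n → ι n * h i ≡ θ f i * g (n ℕ.∸ i) + f i * θ g (n ℕ.∸ i)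
  split i i≤n = trans (cong (_* h i) (ι-∸ i≤n)) (distrib (ι i) (ι (n ℕ.∸ i)) (f i) (g (n ℕ.∸ i)))
∂-one isDerivation-θ = θ-one

-- The Leibniz rule for D is that of θ one degree higher.
isDerivation-D : IsDerivation D
leibniz isDerivation-D f g n = begin
  θ (f ⊛ g) (suc n)                              ≡⟨ leibniz isDerivation-θ f g (suc n) ⟩
  (θ f ⊛ g) (suc n) + (f ⊛ θ g) (suc n)          ≡⟨ cong₂ _+_ θf⊛g f⊛θg ⟩
  (D f ⊛ g) n + (f ⊛ D g) n                      ∎
  where
  θf⊛g : (θ f ⊛ g) (suc n) ≡ (D f ⊛ g) n
  θf⊛g = begin
    (θ f ⊛ g) (suc n)                   ≡⟨ sumTo-suc n _ ⟩
    θ f 0 * g (suc n) + (D f ⊛ g) n     ≡⟨ cong (λ z → z * g (suc n) + (D f ⊛ g) n) (ℚₚ.*-zeroˡ (f 0)) ⟩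
    0ℚ * g (suc n) + (D f ⊛ g) n        ≡⟨ cong (_+ (D f ⊛ g) n) (ℚₚ.*-zeroˡ (g (suc n))) ⟩
    0ℚ + (D f ⊛ g) n                    ≡⟨ ℚₚ.+-identityˡ _ ⟩
    (D f ⊛ g) n                         ∎

  f⊛θg : (f ⊛ θ g) (suc n) ≡ (f ⊛ D g) n
  f⊛θg = begin
    sumTo n (λ i → f i * θ g (suc n ℕ.∸ i)) + f (suc n) * θ g (n ℕ.∸ n)
      ≡⟨ cong₂ _+_ (sumTo-cong≤ n (λ i i≤n → cong (λ e → f i * θ g e) (ℕₚ.+-∸-assoc 1 i≤n)))
                   (cong (λ e → f (suc n) * θ g e) (ℕₚ.n∸n≡0 n)) ⟩
    (f ⊛ D g) n + f (suc n) * (0ℚ * g 0)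
      ≡⟨ cong (λ z → (f ⊛ D g) n + f (suc n) * z) (ℚₚ.*-zeroˡ (g 0)) ⟩
    (f ⊛ D g) n + f (suc n) * 0ℚ
      ≡⟨ cong (λ z → (f ⊛ D g) n + z) (ℚₚ.*-zeroʳ (f (suc n))) ⟩
    (f ⊛ D g) n + 0ℚ
      ≡⟨ ℚₚ.+-identityʳ _ ⟩
    (f ⊛ D g) n
      ∎
∂-one isDerivation-D n = θ-one (suc n)

isDerivation-sub : ∀ {∂ ∂′} → IsDerivation ∂ → IsDerivation ∂′ → IsDerivation (λ f → ∂ f -ˢ ∂′ f)
leibniz (isDerivation-sub {∂} {∂′} P P′) f g n = begin
  ∂ (f ⊛ g) n - ∂′ (f ⊛ g) n
    ≡⟨ cong₂ _-_ (leibniz P f g n) (leibniz P′ f g n) ⟩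
  ((∂ f ⊛ g) n + (f ⊛ ∂ g) n) - ((∂′ f ⊛ g) n + (f ⊛ ∂′ g) n)
    ≡⟨ regroup ((∂ f ⊛ g) n) ((f ⊛ ∂ g) n) ((∂′ f ⊛ g) n) ((f ⊛ ∂′ g) n) ⟩
  ((∂ f ⊛ g) n - (∂′ f ⊛ g) n) + ((f ⊛ ∂ g) n - (f ⊛ ∂′ g) n)
    ≡⟨ cong₂ _+_ (⊛-distribʳ-sub (∂ f) (∂′ f) g n) (⊛-distribˡ-sub f (∂ g) (∂′ g) n) ⟨
  ((∂ f -ˢ ∂′ f) ⊛ g) n + (f ⊛ (∂ g -ˢ ∂′ g)) n
    ∎
  where
  regroup : ∀ a b c d → (a + b) - (c + d) ≡ (a - c) + (b - d)
  regroup = solve 4 (λ a b c d → (a :+ b) :- (c :+ d) := (a :- c) :+ (b :- d)) refl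
∂-one (isDerivation-sub P P′) n = cong₂ _-_ (∂-one P n) (∂-one P′ n)

isDerivation-[1-t]D : IsDerivation [1-t]D
isDerivation-[1-t]D = isDerivation-sub isDerivation-D isDerivation-θ

module _ {∂ : Series → Series} (P : IsDerivation ∂) where

  private
    x+cx≡[1+c]x : ∀ x c → x + c * x ≡ (1ℚ + c) * x
    x+cx≡[1+c]x = solve 2 (λ x c → x :+ c :* x := (con 1ℚ :+ c) :* x) refl

  ∂-^ˢ-eigen : ∀ {G} → ∂ G ≗ G → ∀ j → ∂ (G ^ˢ j) ≗ scale (ι j) (G ^ˢ j)
  ∂-^ˢ-eigen ∂G≗G zero n = trans (∂-one P n) (sym (ℚₚ.*-zeroˡ (one n)))
  ∂-^ˢ-eigen {G} ∂G≗G (suc j) n = begin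
    ∂ (G ⊛ (G ^ˢ j)) n                           ≡⟨ leibniz P G (G ^ˢ j) n ⟩
    (∂ G ⊛ (G ^ˢ j)) n + (G ⊛ ∂ (G ^ˢ j)) n      ≡⟨ cong₂ _+_ (⊛-congˡ (G ^ˢ j) ∂G≗G n)
                                                    (trans (⊛-congʳ G (∂-^ˢ-eigen ∂G≗G j) n) (⊛-scaleʳ (ι j) G (G ^ˢ j) n)) ⟩
    X + ι j * X                                  ≡⟨ x+cx≡[1+c]x X (ι j) ⟩
    (1ℚ + ι j) * X                               ≡⟨ cong (_* X) (ι-suc j) ⟨
    ι (suc j) * X                                ∎
    where
    X : ℚ
    X = (G ^ˢ suc j) n

  -- At k = 0 the term M ^ˢ pred 0 is junk, killed by the factor ι 0 = 0.
  ∂-^ˢ-affine : ∀ {M} → ∂ M ≗ M +ˢ one → ∀ k → ∂ (M ^ˢ k) ≗ scale (ι k) ((M ^ˢ k) +ˢ (M ^ˢ pred k))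
  ∂-^ˢ-affine ∂M≗M+1 zero n = trans (∂-one P n) (sym (ℚₚ.*-zeroˡ (one n + one n)))
  ∂-^ˢ-affine {M} ∂M≗M+1 (suc k) n = begin
    ∂ (M ⊛ (M ^ˢ k)) n                           ≡⟨ leibniz P M (M ^ˢ k) n ⟩
    (∂ M ⊛ (M ^ˢ k)) n + (M ⊛ ∂ (M ^ˢ k)) n      ≡⟨ cong₂ _+_ first second ⟩
    (X + Y) + ι k * (X + (M ⊛ (M ^ˢ pred k)) n)  ≡⟨ cong (λ z → (X + Y) + z) (ι-pred X k) ⟩
    (X + Y) + ι k * (X + Y)                      ≡⟨ x+cx≡[1+c]x (X + Y) (ι k) ⟩
    (1ℚ + ι k) * (X + Y)                         ≡⟨ cong (_* (X + Y)) (ι-suc k) ⟨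
    ι (suc k) * (X + Y)                          ∎
    where
    X Y : ℚ
    X = (M ^ˢ suc k) n
    Y = (M ^ˢ k) n

    first : (∂ M ⊛ (M ^ˢ k)) n ≡ X + Y
    first = begin
      (∂ M ⊛ (M ^ˢ k)) n                    ≡⟨ ⊛-congˡ (M ^ˢ k) ∂M≗M+1 n ⟩
      ((M +ˢ one) ⊛ (M ^ˢ k)) n             ≡⟨ ⊛-distribʳ-+ M one (M ^ˢ k) n ⟩
      X + (one ⊛ (M ^ˢ k)) n                ≡⟨ cong (λ z → X + z) (⊛-identityˡ (M ^ˢ k) n) ⟩
      X + Y                                 ∎

    second : (M ⊛ ∂ (M ^ˢ k)) n ≡ ι k * (X + (M ⊛ (M ^ˢ pred k)) n)
    second = begin
      (M ⊛ ∂ (M ^ˢ k)) n                                      ≡⟨ ⊛-congʳ M (∂-^ˢ-affine ∂M≗M+1 k) n ⟩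
      (M ⊛ scale (ι k) ((M ^ˢ k) +ˢ (M ^ˢ pred k))) n         ≡⟨ ⊛-scaleʳ (ι k) M ((M ^ˢ k) +ˢ (M ^ˢ pred k)) n ⟩
      ι k * (M ⊛ ((M ^ˢ k) +ˢ (M ^ˢ pred k))) n               ≡⟨ cong (ι k *_) (⊛-distribˡ-+ M (M ^ˢ k) (M ^ˢ pred k) n) ⟩
      ι k * (X + (M ⊛ (M ^ˢ pred k)) n)                       ∎

    ι-pred : ∀ x k → ι k * (x + (M ⊛ (M ^ˢ pred k)) n) ≡ ι k * (x + (M ^ˢ k) n)
    ι-pred x zero    = trans (ℚₚ.*-zeroˡ (x + (M ⊛ one) n)) (sym (ℚₚ.*-zeroˡ (x + one n)))
    ι-pred x (suc k) = refl

  ∂-eigen⊛^ˢ : ∀ {A M c} → ∂ A ≗ scale c A → ∂ M ≗ M +ˢ one → ∀ k →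
               ∂ (A ⊛ (M ^ˢ k)) ≗ scale (ι k + c) (A ⊛ (M ^ˢ k)) +ˢ scale (ι k) (A ⊛ (M ^ˢ pred k))
  ∂-eigen⊛^ˢ {A} {M} {c} ∂A≗cA ∂M≗M+1 k n = begin
    ∂ (A ⊛ (M ^ˢ k)) n                          ≡⟨ leibniz P A (M ^ˢ k) n ⟩
    (∂ A ⊛ (M ^ˢ k)) n + (A ⊛ ∂ (M ^ˢ k)) n     ≡⟨ cong₂ _+_ first second ⟩
    c * X + ι k * (X + Y)                       ≡⟨ regroup c (ι k) X Y ⟩
    (ι k + c) * X + ι k * Y                     ∎
    where
    X Y : ℚ
    X = (A ⊛ (M ^ˢ k)) n
    Y = (A ⊛ (M ^ˢ pred k)) n
    regroup : ∀ c d x y → c * x + d * (x + y) ≡ (d + c) * x + d * y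
    regroup = solve 4 (λ c d x y → c :* x :+ d :* (x :+ y) := (d :+ c) :* x :+ d :* y) refl
    first : (∂ A ⊛ (M ^ˢ k)) n ≡ c * X
    first = trans (⊛-congˡ (M ^ˢ k) ∂A≗cA n) (⊛-scaleˡ c A (M ^ˢ k) n)
    second : (A ⊛ ∂ (M ^ˢ k)) n ≡ ι k * (X + Y)
    second = begin
      (A ⊛ ∂ (M ^ˢ k)) n                                ≡⟨ ⊛-congʳ A (∂-^ˢ-affine ∂M≗M+1 k) n ⟩
      (A ⊛ scale (ι k) ((M ^ˢ k) +ˢ (M ^ˢ pred k))) n   ≡⟨ ⊛-scaleʳ (ι k) A ((M ^ˢ k) +ˢ (M ^ˢ pred k)) n ⟩
      ι k * (A ⊛ ((M ^ˢ k) +ˢ (M ^ˢ pred k))) n         ≡⟨ cong (ι k *_) (⊛-distribˡ-+ A (M ^ˢ k) (M ^ˢ pred k) n) ⟩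
      ι k * (X + Y)                                     ∎

  ∂-^ˢ⊛eigen : ∀ {M B c} → ∂ M ≗ M +ˢ one → ∂ B ≗ scale c B → ∀ k →
               ∂ ((M ^ˢ k) ⊛ B) ≗ scale (ι k + c) ((M ^ˢ k) ⊛ B) +ˢ scale (ι k) ((M ^ˢ pred k) ⊛ B)
  ∂-^ˢ⊛eigen {M} {B} {c} ∂M≗M+1 ∂B≗cB k n = begin
    ∂ ((M ^ˢ k) ⊛ B) n                          ≡⟨ leibniz P (M ^ˢ k) B n ⟩
    (∂ (M ^ˢ k) ⊛ B) n + ((M ^ˢ k) ⊛ ∂ B) n     ≡⟨ cong₂ _+_ first second ⟩
    ι k * (X + Y) + c * X                       ≡⟨ regroup c (ι k) X Y ⟩
    (ι k + c) * X + ι k * Y                     ∎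
    where
    X Y : ℚ
    X = ((M ^ˢ k) ⊛ B) n
    Y = ((M ^ˢ pred k) ⊛ B) n
    regroup : ∀ c d x y → d * (x + y) + c * x ≡ (d + c) * x + d * y
    regroup = solve 4 (λ c d x y → d :* (x :+ y) :+ c :* x := (d :+ c) :* x :+ d :* y) refl
    first : (∂ (M ^ˢ k) ⊛ B) n ≡ ι k * (X + Y)
    first = begin
      (∂ (M ^ˢ k) ⊛ B) n                                ≡⟨ ⊛-congˡ B (∂-^ˢ-affine ∂M≗M+1 k) n ⟩
      (scale (ι k) ((M ^ˢ k) +ˢ (M ^ˢ pred k)) ⊛ B) n   ≡⟨ ⊛-scaleˡ (ι k) ((M ^ˢ k) +ˢ (M ^ˢ pred k)) B n ⟩
      ι k * (((M ^ˢ k) +ˢ (M ^ˢ pred k)) ⊛ B) n         ≡⟨ cong (ι k *_) (⊛-distribʳ-+ (M ^ˢ k) (M ^ˢ pred k) B n) ⟩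
      ι k * (X + Y)                                     ∎
    second : ((M ^ˢ k) ⊛ ∂ B) n ≡ c * X
    second = trans (⊛-congʳ (M ^ˢ k) ∂B≗cB n) (⊛-scaleʳ c (M ^ˢ k) B n)

D≡[1-t]D+θ : ∀ f n → D f n ≡ [1-t]D f n + θ f n
D≡[1-t]D+θ f n = solve 2 (λ a b → a := (a :- b) :+ b) refl (D f n) (θ f n)

D-expS : ∀ x → D (expS x) ≗ scale x (expS x)
D-expS x n = begin
  ι (suc n) * ((x * (x ^ᵠ n)) * invFact (suc n))  ≡⟨ rearrange (ι (suc n)) x (x ^ᵠ n) (invFact (suc n)) ⟩
  x * ((x ^ᵠ n) * (ι (suc n) * invFact (suc n)))  ≡⟨ cong (λ z → x * ((x ^ᵠ n) * z)) (invFact-suc n) ⟨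
  x * ((x ^ᵠ n) * invFact n)                      ∎
  where
  rearrange : ∀ a b c d → a * ((b * c) * d) ≡ b * (c * (a * d))
  rearrange = solve 4 (λ a b c d → a :* ((b :* c) :* d) := b :* (c :* (a :* d))) refl

D-expMinusOne : D expMinusOne ≗ expMinusOne +ˢ one
D-expMinusOne zero    = refl
D-expMinusOne (suc n) = trans (sym (invFact-suc (suc n))) (sym (ℚₚ.+-identityʳ (invFact (suc n))))

[1-t]D-geom : [1-t]D geom ≗ geom
[1-t]D-geom n = begin
  ι (suc n) * 1ℚ - ι n * 1ℚ         ≡⟨ cong (λ z → z * 1ℚ - ι n * 1ℚ) (ι-suc n) ⟩
  (1ℚ + ι n) * 1ℚ - ι n * 1ℚ        ≡⟨ solve 1 (λ a → (con 1ℚ :+ a) :* con 1ℚ :- a :* con 1ℚ := con 1ℚ) refl (ι n) ⟩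
  1ℚ                                ∎

[1-t]D-geomMinusOne : [1-t]D geomMinusOne ≗ geomMinusOne +ˢ one
[1-t]D-geomMinusOne zero    = refl
[1-t]D-geomMinusOne (suc n) = trans ([1-t]D-geom (suc n)) (sym (ℚₚ.+-identityʳ 1ℚ))

-- Exponential generating functions

egf-isTriangle : (F : ℕ → Series) (c : ℕ → ℕ → ℚ) →
                 (∀ k → F k 0 ≡ one k) →
                 (∀ n k → D (F k) n ≡ c n k * F k n + ι k * F (pred k) n) →
                 IsTriangle c (λ n k → egfCoeff (scale (invFact k) (F k)) n)
row-zero (egf-isTriangle F c F-at-0 D-F) k =
  trans (cong (λ z → ι 1 * (invFact k * z)) (F-at-0 k)) (coefficient k)
  where
  coefficient : ∀ k → ι 1 * (invFact k * one k) ≡ one k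
  coefficient zero    = refl
  coefficient (suc k) = cong (ι 1 *_) (ℚₚ.*-zeroʳ (invFact (suc k)))
row-suc (egf-isTriangle F c F-at-0 D-F) n k = begin
  ι (suc n !) * (invFact k * F k (suc n))
    ≡⟨ cong (_* (invFact k * F k (suc n))) (ι-* (suc n) (n !)) ⟩
  (ι (suc n) * ι (n !)) * (invFact k * F k (suc n))
    ≡⟨ rearrange (ι (suc n)) (ι (n !)) (invFact k) (F k (suc n)) ⟩
  (ι (n !) * invFact k) * D (F k) n
    ≡⟨ cong ((ι (n !) * invFact k) *_) (D-F n k) ⟩
  (ι (n !) * invFact k) * (c n k * F k n + ι k * F (pred k) n)
    ≡⟨ expand (ι (n !)) (invFact k) (c n k) (F k n) (ι k) (F (pred k) n) ⟩
  ι (n !) * ((ι k * invFact k) * F (pred k) n) + c n k * C n k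
    ≡⟨ cong (_+ c n k * C n k) (lowered k) ⟩
  shift (C n) k + c n k * C n k
    ∎
  where
  C : ℕ → ℕ → ℚ
  C n k = ι (n !) * (invFact k * F k n)

  rearrange : ∀ a b c d → (a * b) * (c * d) ≡ (b * c) * (a * d)
  rearrange = solve 4 (λ a b c d → (a :* b) :* (c :* d) := (b :* c) :* (a :* d)) refl

  expand : ∀ a b c d e f → (a * b) * (c * d + e * f) ≡ a * ((e * b) * f) + c * (a * (b * d))
  expand = solve 6 (λ a b c d e f → (a :* b) :* (c :* d :+ e :* f) := a :* ((e :* b) :* f) :+ c :* (a :* (b :* d))) refl

  lowered : ∀ k → ι (n !) * ((ι k * invFact k) * F (pred k) n) ≡ shift (C n) k
  lowered zero    = trans (cong (ι (n !) *_) (ℚₚ.*-zeroˡ (F 0 n))) (ℚₚ.*-zeroʳ (ι (n !)))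
  lowered (suc k) = cong (λ z → ι (n !) * (z * F k n)) (sym (invFact-suc k))

S₂-isTriangle : ∀ x → IsTriangle (λ _ k → ι k + x) (λ m k → S₂ m k x)
S₂-isTriangle x = egf-isTriangle F (λ _ k → ι k + x) F-at-0
  (λ n k → ∂-eigen⊛^ˢ isDerivation-D (D-expS x) D-expMinusOne k n)
  where
  F : ℕ → Series
  F k = expS x ⊛ (expMinusOne ^ˢ k)
  F-at-0 : ∀ k → F k 0 ≡ one k
  F-at-0 k = trans (ℚₚ.*-identityˡ _) (trans (^ˢ-constantTerm expMinusOne k) (0ℚ^ᵠ≡one k))

lah-isTriangle : ∀ r → IsTriangle (λ n k → ι n + (ι k + ι (2 ℕ.* r))) (lah r)
lah-isTriangle r = egf-isTriangle F _ F-at-0 D-F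
  where
  x : ℚ
  x = ι (2 ℕ.* r)
  F : ℕ → Series
  F k = (geomMinusOne ^ˢ k) ⊛ (geom ^ˢ (2 ℕ.* r))

  F-at-0 : ∀ k → F k 0 ≡ one k
  F-at-0 k = begin
    (geomMinusOne ^ˢ k) 0 * (geom ^ˢ (2 ℕ.* r)) 0
      ≡⟨ cong₂ _*_ (trans (^ˢ-constantTerm geomMinusOne k) (0ℚ^ᵠ≡one k))
                   (trans (^ˢ-constantTerm geom (2 ℕ.* r)) (1ℚ^ᵠ≡1ℚ (2 ℕ.* r))) ⟩
    one k * 1ℚ
      ≡⟨ ℚₚ.*-identityʳ (one k) ⟩
    one k
      ∎

  [1-t]D-F : ∀ k → [1-t]D (F k) ≗ scale (ι k + x) (F k) +ˢ scale (ι k) (F (pred k))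
  [1-t]D-F = ∂-^ˢ⊛eigen isDerivation-[1-t]D [1-t]D-geomMinusOne
               (∂-^ˢ-eigen isDerivation-[1-t]D [1-t]D-geom (2 ℕ.* r))

  D-F : ∀ n k → D (F k) n ≡ (ι n + (ι k + x)) * F k n + ι k * F (pred k) n
  D-F n k = begin
    D (F k) n                                                   ≡⟨ D≡[1-t]D+θ (F k) n ⟩
    [1-t]D (F k) n + ι n * F k n                                ≡⟨ cong (_+ ι n * F k n) ([1-t]D-F k n) ⟩
    ((ι k + x) * F k n + ι k * F (pred k) n) + ι n * F k n     ≡⟨ regroup (ι k + x) (F k n) (ι k * F (pred k) n) (ι n) ⟩
    (ι n + (ι k + x)) * F k n + ι k * F (pred k) n              ∎
    where
    regroup : ∀ a b c d → (a * b + c) + d * b ≡ (d + a) * b + c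
    regroup = solve 4 (λ a b c d → (a :* b :+ c) :+ d :* b := (d :+ a) :* b :+ c) refl

unsignedS₁ : ℕ → ℕ → ℚ
unsignedS₁ n m = (- 1ℚ) ^ᵠ (n ℕ.∸ m) * toℚ (S₁ n m)

S₁-zero-above : ∀ {n m} → n < m → S₁ n m ≡ + 0
S₁-zero-above {zero}  {suc m} _         = refl
S₁-zero-above {suc n} {suc m} (s≤s n<m) =
  trans (cong₂ (λ a b → a ℤ.- + n ℤ.* b) (S₁-zero-above n<m) (S₁-zero-above (ℕₚ.m≤n⇒m≤1+n n<m)))
        (cong (λ z → + 0 ℤ.- z) (ℤₚ.*-zeroʳ (+ n)))

unsignedS₁-isTriangle : IsTriangle (λ n _ → ι n) unsignedS₁
row-zero unsignedS₁-isTriangle zero    = refl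
row-zero unsignedS₁-isTriangle (suc m) = refl
row-suc unsignedS₁-isTriangle n zero = begin
  ((- 1ℚ) * σ) * toℚ (ℤ.- (+ n ℤ.* S₁ n 0))
    ≡⟨ cong (((- 1ℚ) * σ) *_) (trans (toℚ-neg (+ n ℤ.* S₁ n 0)) (cong -_ (toℚ-* (+ n) (S₁ n 0)))) ⟩
  ((- 1ℚ) * σ) * - (ι n * toℚ (S₁ n 0))
    ≡⟨ solve 3 (λ s q t → (con (- 1ℚ) :* s) :* (:- (q :* t)) := con 0ℚ :+ q :* (s :* t)) refl σ (ι n) (toℚ (S₁ n 0)) ⟩
  0ℚ + ι n * unsignedS₁ n 0
    ∎
  where
  σ : ℚ
  σ = (- 1ℚ) ^ᵠ n
row-suc unsignedS₁-isTriangle n (suc m) = begin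
  σ (n ℕ.∸ m) * toℚ (S₁ n m ℤ.- + n ℤ.* S₁ n (suc m))
    ≡⟨ cong (σ (n ℕ.∸ m) *_) (trans (toℚ-sub (S₁ n m) (+ n ℤ.* S₁ n (suc m)))
                                    (cong (λ z → toℚ (S₁ n m) - z) (toℚ-* (+ n) (S₁ n (suc m))))) ⟩
  σ (n ℕ.∸ m) * (toℚ (S₁ n m) - ι n * toℚ (S₁ n (suc m)))
    ≡⟨ by-sign (m ℕₚ.<? n) ⟩
  unsignedS₁ n m + ι n * unsignedS₁ n (suc m)
    ∎
  where
  σ : ℕ → ℚ
  σ e = (- 1ℚ) ^ᵠ e

  ∸-suc : m < n → n ℕ.∸ m ≡ suc (n ℕ.∸ suc m)
  ∸-suc = ℕₚ.+-∸-assoc 1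

  -- For n ≤ m the exponent n ∸ m is truncated, but then S₁ n (suc m) = 0.
  by-sign : Dec (m < n) → σ (n ℕ.∸ m) * (toℚ (S₁ n m) - ι n * toℚ (S₁ n (suc m))) ≡
                          unsignedS₁ n m + ι n * unsignedS₁ n (suc m)
  by-sign (yes m<n) rewrite ∸-suc m<n =
    solve 4 (λ s t q u → (con (- 1ℚ) :* s) :* (t :- q :* u) := (con (- 1ℚ) :* s) :* t :+ q :* (s :* u))
      refl (σ (n ℕ.∸ suc m)) (toℚ (S₁ n m)) (ι n) (toℚ (S₁ n (suc m)))
  by-sign (no m≮n) rewrite S₁-zero-above (s≤s (ℕₚ.≮⇒≥ m≮n)) =
    solve 4 (λ s t q s′ → s :* (t :- q :* con 0ℚ) := s :* t :+ q :* (s′ :* con 0ℚ))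
      refl (σ (n ℕ.∸ m)) (toℚ (S₁ n m)) (ι n) (σ (n ℕ.∸ suc m))

theorem8 : (n k r : ℕ) → k ≤ n →
    lah r n k ≡
      sumFromTo k n (λ m → ((ℚ.- ℚ.1ℚ) ^ᵠ (n ℕ.∸ m)) ℚ.* S₂ m k (toℚ (+ (2 ℕ.* r))) ℚ.* toℚ (S₁ n m))
theorem8 n k r k≤n = begin
  lah r n k
    ≡⟨ IsTriangle-unique (lah-isTriangle r) (IsTriangle-⋆ unsignedS₁-isTriangle (S₂-isTriangle x)) n k ⟩
  sumTo n (λ m → unsignedS₁ n m * S₂ m k x)
    ≡⟨ sumTo-cong n (λ m → xy∙z≈xz∙y ((- 1ℚ) ^ᵠ (n ℕ.∸ m)) (toℚ (S₁ n m)) (S₂ m k x)) ⟩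
  sumTo n summand
    ≡⟨ sumFromTo≡sumTo summand k≤n summand-below-k ⟨
  sumFromTo k n summand
    ∎
  where
  x : ℚ
  x = toℚ (+ (2 ℕ.* r))

  summand : ℕ → ℚ
  summand m = ((- 1ℚ) ^ᵠ (n ℕ.∸ m)) * S₂ m k x * toℚ (S₁ n m)

  summand-below-k : ∀ m → m < k → summand m ≡ 0ℚ
  summand-below-k m m<k = begin
    (σ * S₂ m k x) * toℚ (S₁ n m)  ≡⟨ cong (λ z → (σ * z) * toℚ (S₁ n m)) (IsTriangle-zero-above (S₂-isTriangle x) m<k) ⟩
    (σ * 0ℚ) * toℚ (S₁ n m)        ≡⟨ cong (_* toℚ (S₁ n m)) (ℚₚ.*-zeroʳ σ) ⟩
    0ℚ * toℚ (S₁ n m)              ≡⟨ ℚₚ.*-zeroˡ (toℚ (S₁ n m)) ⟩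
    0ℚ                             ∎
    where
    σ : ℚ
    σ = (- 1ℚ) ^ᵠ (n ℕ.∸ m)
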